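{- Let $\mathbf A\in\mathbf G_{\mathsf{FL}_{\mathsf e}}(\mathsf{BA})$ and let ${\Rightarrow}\in\{\Rightarrow_{\circ},\Rightarrow_{\wedge}\}$. Then ${\Rightarrow}$ is symmetric on $\mathbf A$ (i.e. $x{\Rightarrow} y=y{\Rightarrow} x$ for all $x,y\in A$) if and only if $\mathbf A$ is a Boolean algebra (i.e. $\mathbf A$ satisfies $x\cdot y=x\wedge y$ and $x\to y=\neg x\vee y$).
   Context: An FL${}_{\mathrm e}$-algebra is an algebra $\langle A,\wedge,\vee,\cdot,\to,0,1\rangle$ such that $\langle A,\wedge,\vee\rangle$ is a lattice (with order $\leq$), $\langle A,\cdot,1\rangle$ is a commutative monoid, $0$ is an arbitrary constant, and $x\cdot y\leq z\iff x\leq y\to z$. Write $\neg x:=x\to 0$, $x\Rightarrow_{\wedge} y:=(x\to y)\wedge(y\to\neg\neg x)$ and $x\Rightarrow_{\circ} y:=(x\to y)\cdot(y\to\neg\neg x)$. $\mathsf{BA}$ is the variety of Boolean algebras viewed as FL${}_{\mathrm e}$-algebras satisfying $x\cdot y=x\wedge y$ and $x\to y=\neg x\vee y$; $\mathbf G_{\mathsf{FL}_{\mathsf e}}(\mathsf{BA})$ is the largest variety $\mathsf W$ of FL${}_{\mathrm e}$-algebras such that for every equation $s\approx t$, $\mathsf{BA}\models s\approx t$ iff $\mathsf W\models\neg s\approx\neg t$. -}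

module Defs where

open import Data.Nat using (ℕ)
open import Data.Product using (_×_; Σ)
open import Relation.Binary.PropositionalEquality using (_≡_)
open import Function.Bundles using (_⇔_)
open import Level using (Level) renaming (suc to lsuc)

record FLe : Set₁ where
  infixr 6 _⊓_ _⊔_
  infixr 7 _∙_
  infixr 5 _⇾_
  field
    Carrier : Set
    _⊓_ _⊔_ _∙_ _⇾_ : Carrier → Carrier → Carrier
    𝟘 𝟙 : Carrier
    ⊓-comm   : ∀ x y → x ⊓ y ≡ y ⊓ x
    ⊓-assoc  : ∀ x y z → (x ⊓ y) ⊓ z ≡ x ⊓ (y ⊓ z)
    ⊔-comm   : ∀ x y → x ⊔ y ≡ y ⊔ x
    ⊔-assoc  : ∀ x y z → (x ⊔ y) ⊔ z ≡ x ⊔ (y ⊔ z)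
    ⊓-absorbs-⊔ : ∀ x y → x ⊓ (x ⊔ y) ≡ x
    ⊔-absorbs-⊓ : ∀ x y → x ⊔ (x ⊓ y) ≡ x
    ∙-assoc  : ∀ x y z → (x ∙ y) ∙ z ≡ x ∙ (y ∙ z)
    ∙-comm   : ∀ x y → x ∙ y ≡ y ∙ x
    ∙-identityˡ : ∀ x → 𝟙 ∙ x ≡ x
  _≤_ : Carrier → Carrier → Set
  x ≤ y = x ⊓ y ≡ x
  field
    residuation : ∀ x y z → ((x ∙ y) ≤ z → x ≤ (y ⇾ z)) × (x ≤ (y ⇾ z) → (x ∙ y) ≤ z)

  ¬_ : Carrier → Carrier
  ¬ x = x ⇾ 𝟘

  _⇒∧_ : Carrier → Carrier → Carrier
  x ⇒∧ y = (x ⇾ y) ⊓ (y ⇾ ¬ (¬ x))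

  _⇒∘_ : Carrier → Carrier → Carrier
  x ⇒∘ y = (x ⇾ y) ∙ (y ⇾ ¬ (¬ x))

open FLe public using (Carrier)

IsBA : FLe → Set
IsBA A = (∀ x y → x ∙ y ≡ x ⊓ y) × (∀ x y → x ⇾ y ≡ (¬ x) ⊔ y)
  where open FLe A

data Term : Set where
  var : ℕ → Term
  _∧ₜ_ _∨ₜ_ _·ₜ_ _→ₜ_ : Term → Term → Term
  0ₜ 1ₜ : Term

¬ₜ_ : Term → Term
¬ₜ s = s →ₜ 0ₜ

⟦_⟧ : Term → (A : FLe) → (ℕ → Carrier A) → Carrier A
⟦ var i ⟧ A ρ = ρ i
⟦ s ∧ₜ t ⟧ A ρ = FLe._⊓_ A (⟦ s ⟧ A ρ) (⟦ t ⟧ A ρ)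
⟦ s ∨ₜ t ⟧ A ρ = FLe._⊔_ A (⟦ s ⟧ A ρ) (⟦ t ⟧ A ρ)
⟦ s ·ₜ t ⟧ A ρ = FLe._∙_ A (⟦ s ⟧ A ρ) (⟦ t ⟧ A ρ)
⟦ s →ₜ t ⟧ A ρ = FLe._⇾_ A (⟦ s ⟧ A ρ) (⟦ t ⟧ A ρ)
⟦ 0ₜ ⟧ A ρ = FLe.𝟘 A
⟦ 1ₜ ⟧ A ρ = FLe.𝟙 A

_⊨_≈_ : FLe → Term → Term → Set
A ⊨ s ≈ t = ∀ (ρ : ℕ → Carrier A) → ⟦ s ⟧ A ρ ≡ ⟦ t ⟧ A ρ

BA⊨_≈_ : Term → Term → Set₁
BA⊨ s ≈ t = ∀ (B : FLe) → IsBA B → B ⊨ s ≈ t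

-- A variety of FLe-algebras is Mod(E) for a set E of equations (Birkhoff).
Mod : (Term → Term → Set) → FLe → Set
Mod E B = ∀ s t → E s t → B ⊨ s ≈ t

-- W = Mod(E) has the defining property of G(BA):
-- BA ⊨ s ≈ t  iff  W ⊨ ¬s ≈ ¬t, for all equations s ≈ t.
GProperty : (Term → Term → Set) → Set₁
GProperty E = ∀ s t → (BA⊨ s ≈ t) ⇔ (∀ (B : FLe) → Mod E B → B ⊨ (¬ₜ s) ≈ (¬ₜ t))

-- A ∈ G_FLe(BA): A lies in the largest variety with that property,
-- i.e. A belongs to some variety with that property.
InG : FLe → Set₁
InG A = Σ (Term → Term → Set) λ E → GProperty E × Mod E A

data Arrow : Set where
  circ wedge : Arrow

arrowOp : (A : FLe) → Arrow → Carrier A → Carrier A → Carrier A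
arrowOp A circ  = FLe._⇒∘_ A
arrowOp A wedge = FLe._⇒∧_ A

SymmetricOn : (A : FLe) → Arrow → Set
SymmetricOn A a = ∀ x y → arrowOp A a x y ≡ arrowOp A a y x

{-# OPTIONS --safe #-}
-- Both ⇒∘ and ⇒∧ become symmetric as soon as ¬ is an involution, since then
-- y → ¬¬x is just y → x.  Conversely, symmetry forces ¬¬x ≤ x: the element
-- x ⇒ ¬¬x lies above 1, while ¬¬x ⇒ x is built from ¬¬x → x; for ⇒∧ this is
-- immediate, for ⇒∘ it takes a short residuation chain.
-- On an algebra of G(BA) every Boolean law s ≈ t holds in the form ¬s ≈ ¬t,
-- and an involutive ¬ is injective, so the Boolean laws themselves hold.
module Submission where

open import Defs
open import Algebra.Definitions using (Involutive)
open import Data.Nat using (ℕ; zero; suc)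
open import Data.Product using (_,_; proj₁; proj₂)
open import Function.Bundles using (_⇔_; mk⇔; Equivalence)
open import Relation.Binary.Bundles using (Poset)
open import Relation.Binary.Structures using (IsPartialOrder)
open import Relation.Binary.PropositionalEquality

module FLeProperties (A : FLe) where
  open FLe A renaming (_≤_ to infix 4 _≤_)

  ⊓-idem : ∀ x → x ⊓ x ≡ x
  ⊓-idem x = begin
    x ⊓ x             ≡⟨ cong (x ⊓_) (⊔-absorbs-⊓ x x) ⟨
    x ⊓ (x ⊔ x ⊓ x)   ≡⟨ ⊓-absorbs-⊔ x (x ⊓ x) ⟩
    x                 ∎
    where open ≡-Reasoning

  ≤-refl : ∀ x → x ≤ x
  ≤-refl = ⊓-idem

  ≤-reflexive : ∀ {x y} → x ≡ y → x ≤ y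
  ≤-reflexive {x} refl = ≤-refl x

  ≤-trans : ∀ {x y z} → x ≤ y → y ≤ z → x ≤ z
  ≤-trans {x} {y} {z} x≤y y≤z = begin
    x ⊓ z         ≡⟨ cong (_⊓ z) x≤y ⟨
    (x ⊓ y) ⊓ z   ≡⟨ ⊓-assoc x y z ⟩
    x ⊓ (y ⊓ z)   ≡⟨ cong (x ⊓_) y≤z ⟩
    x ⊓ y         ≡⟨ x≤y ⟩
    x             ∎
    where open ≡-Reasoning

  ≤-antisym : ∀ {x y} → x ≤ y → y ≤ x → x ≡ y
  ≤-antisym {x} {y} x≤y y≤x = trans (sym x≤y) (trans (⊓-comm x y) y≤x)

  ≤-isPartialOrder : IsPartialOrder _≡_ _≤_
  ≤-isPartialOrder = record
    { isPreorder = record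
      { isEquivalence = isEquivalence
      ; reflexive     = ≤-reflexive
      ; trans         = ≤-trans
      }
    ; antisym = ≤-antisym
    }

  ≤-poset : Poset _ _ _
  ≤-poset = record { isPartialOrder = ≤-isPartialOrder }

  ⊓-greatest : ∀ {x y z} → z ≤ x → z ≤ y → z ≤ x ⊓ y
  ⊓-greatest {x} {y} {z} z≤x z≤y =
    trans (sym (⊓-assoc z x y)) (trans (cong (_⊓ y) z≤x) z≤y)

  x⊓y≤x : ∀ x y → x ⊓ y ≤ x
  x⊓y≤x x y = begin
    (x ⊓ y) ⊓ x   ≡⟨ cong (_⊓ x) (⊓-comm x y) ⟩
    (y ⊓ x) ⊓ x   ≡⟨ ⊓-assoc y x x ⟩
    y ⊓ (x ⊓ x)   ≡⟨ cong (y ⊓_) (⊓-idem x) ⟩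
    y ⊓ x         ≡⟨ ⊓-comm y x ⟩
    x ⊓ y         ∎
    where open ≡-Reasoning

  ∙-identityʳ : ∀ x → x ∙ 𝟙 ≡ x
  ∙-identityʳ x = trans (∙-comm x 𝟙) (∙-identityˡ x)

  curry : ∀ {x y z} → x ∙ y ≤ z → x ≤ y ⇾ z
  curry {x} {y} {z} = proj₁ (residuation x y z)

  uncurry : ∀ {x y z} → x ≤ y ⇾ z → x ∙ y ≤ z
  uncurry {x} {y} {z} = proj₂ (residuation x y z)

  modus-ponens : ∀ x y → x ∙ (x ⇾ y) ≤ y
  modus-ponens x y =
    ≤-trans (≤-reflexive (∙-comm x (x ⇾ y))) (uncurry (≤-refl (x ⇾ y)))

  ∙-monoˡ-≤ : ∀ z {x y} → x ≤ y → x ∙ z ≤ y ∙ z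
  ∙-monoˡ-≤ z {y = y} x≤y = uncurry (≤-trans x≤y (curry (≤-refl (y ∙ z))))

  ∙-monoʳ-≤ : ∀ z {x y} → x ≤ y → z ∙ x ≤ z ∙ y
  ∙-monoʳ-≤ z {x} {y} x≤y = subst₂ _≤_ (∙-comm x z) (∙-comm y z) (∙-monoˡ-≤ z x≤y)

  ∙-inflationary : ∀ x {y} → 𝟙 ≤ y → x ≤ x ∙ y
  ∙-inflationary x 𝟙≤y = ≤-trans (≤-reflexive (sym (∙-identityʳ x))) (∙-monoʳ-≤ x 𝟙≤y)

  𝟙≤⇾ : ∀ {x y} → x ≤ y → 𝟙 ≤ x ⇾ y
  𝟙≤⇾ {x} x≤y = curry (≤-trans (≤-reflexive (∙-identityˡ x)) x≤y)

  𝟙≤⇾⇒≤ : ∀ {x y} → 𝟙 ≤ x ⇾ y → x ≤ y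
  𝟙≤⇾⇒≤ {x} 𝟙≤x⇾y = ≤-trans (≤-reflexive (sym (∙-identityˡ x))) (uncurry 𝟙≤x⇾y)

  ⇾-antitoneˡ : ∀ z {x y} → x ≤ y → y ⇾ z ≤ x ⇾ z
  ⇾-antitoneˡ z {x} {y} x≤y =
    curry (≤-trans (∙-monoʳ-≤ (y ⇾ z) x≤y)
                   (≤-trans (≤-reflexive (∙-comm (y ⇾ z) y)) (modus-ponens y z)))

  x≤¬¬x : ∀ x → x ≤ ¬ ¬ x
  x≤¬¬x x = curry (modus-ponens x 𝟘)

  ¬¬¬x≡¬x : ∀ x → ¬ ¬ ¬ x ≡ ¬ x
  ¬¬¬x≡¬x x = ≤-antisym (⇾-antitoneˡ 𝟘 (x≤¬¬x x)) (x≤¬¬x (¬ x))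

  ¬-injective : Involutive _≡_ ¬_ → ∀ {x y} → ¬ x ≡ ¬ y → x ≡ y
  ¬-injective ¬¬-inv {x} {y} ¬x≡¬y =
    trans (sym (¬¬-inv x)) (trans (cong ¬_ ¬x≡¬y) (¬¬-inv y))

  swap-⇾ : Involutive _≡_ ¬_ → (_○_ : Carrier A → Carrier A → Carrier A) →
           (∀ u v → u ○ v ≡ v ○ u) →
           ∀ x y → (x ⇾ y) ○ (y ⇾ ¬ ¬ x) ≡ (y ⇾ x) ○ (x ⇾ ¬ ¬ y)
  swap-⇾ ¬¬-inv _○_ ○-comm x y = begin
    (x ⇾ y) ○ (y ⇾ ¬ ¬ x)   ≡⟨ cong (λ z → (x ⇾ y) ○ (y ⇾ z)) (¬¬-inv x) ⟩
    (x ⇾ y) ○ (y ⇾ x)       ≡⟨ ○-comm (x ⇾ y) (y ⇾ x) ⟩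
    (y ⇾ x) ○ (x ⇾ y)       ≡⟨ cong (λ z → (y ⇾ x) ○ (x ⇾ z)) (¬¬-inv y) ⟨
    (y ⇾ x) ○ (x ⇾ ¬ ¬ y)   ∎
    where open ≡-Reasoning

  involutive⇒symmetric : Involutive _≡_ ¬_ → ∀ a → SymmetricOn A a
  involutive⇒symmetric ¬¬-inv circ  = swap-⇾ ¬¬-inv _∙_ ∙-comm
  involutive⇒symmetric ¬¬-inv wedge = swap-⇾ ¬¬-inv _⊓_ ⊓-comm

  symmetric⇒involutive : ∀ a → SymmetricOn A a → Involutive _≡_ ¬_
  symmetric⇒involutive wedge symmetric x = ≤-antisym (𝟙≤⇾⇒≤ 𝟙≤¬¬x⇾x) (x≤¬¬x x)
    where
    open import Relation.Binary.Reasoning.PartialOrder ≤-poset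
    𝟙≤¬¬x⇾x : 𝟙 ≤ ¬ ¬ x ⇾ x
    𝟙≤¬¬x⇾x = begin
      𝟙                ≤⟨ ⊓-greatest (𝟙≤⇾ (x≤¬¬x x)) (𝟙≤⇾ (≤-refl (¬ ¬ x))) ⟩
      x ⇒∧ (¬ ¬ x)     ≡⟨ symmetric x (¬ ¬ x) ⟩
      (¬ ¬ x) ⇒∧ x     ≤⟨ x⊓y≤x (¬ ¬ x ⇾ x) _ ⟩
      ¬ ¬ x ⇾ x        ∎
  symmetric⇒involutive circ symmetric x = ≤-antisym ¬¬x≤x (x≤¬¬x x)
    where
    open import Relation.Binary.Reasoning.PartialOrder ≤-poset
    n = ¬ ¬ x
    u = x ⇾ n
    v = n ⇾ x
    e = n ⇾ n
    𝟙≤u : 𝟙 ≤ u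
    𝟙≤u = 𝟙≤⇾ (x≤¬¬x x)
    𝟙≤e : 𝟙 ≤ e
    𝟙≤e = 𝟙≤⇾ (≤-refl n)
    -- x ⇒∘ n is u ∙ e, and n ⇒∘ x is v ∙ u because ¬¬n = n
    u∙e≡v∙u : u ∙ e ≡ v ∙ u
    u∙e≡v∙u = trans (symmetric x n) (cong (λ z → v ∙ (x ⇾ z)) (¬¬¬x≡¬x (¬ x)))
    ¬¬x≤x : n ≤ x
    ¬¬x≤x = begin
      n               ≤⟨ ∙-inflationary n (≤-trans 𝟙≤u (∙-inflationary u 𝟙≤e)) ⟩
      n ∙ (u ∙ e)     ≡⟨ cong (n ∙_) u∙e≡v∙u ⟩
      n ∙ (v ∙ u)     ≡⟨ ∙-assoc n v u ⟨
      (n ∙ v) ∙ u     ≤⟨ ∙-monoˡ-≤ u (modus-ponens n x) ⟩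
      x ∙ u           ≤⟨ ∙-inflationary (x ∙ u) 𝟙≤e ⟩
      (x ∙ u) ∙ e     ≡⟨ ∙-assoc x u e ⟩
      x ∙ (u ∙ e)     ≡⟨ cong (x ∙_) u∙e≡v∙u ⟩
      x ∙ (v ∙ u)     ≡⟨ ∙-assoc x v u ⟨
      (x ∙ v) ∙ u     ≡⟨ cong (_∙ u) (∙-comm x v) ⟩
      (v ∙ x) ∙ u     ≡⟨ ∙-assoc v x u ⟩
      v ∙ (x ∙ u)     ≤⟨ ∙-monoʳ-≤ v (modus-ponens x n) ⟩
      v ∙ n           ≡⟨ ∙-comm v n ⟩
      n ∙ v           ≤⟨ modus-ponens n x ⟩
      x               ∎

  isBA⇒involutive : IsBA A → Involutive _≡_ ¬_
  isBA⇒involutive (_ , ⇾-classical) x = ≤-antisym (𝟙≤⇾⇒≤ 𝟙≤¬¬x⇾x) (x≤¬¬x x)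
    where
    open ≡-Reasoning
    ¬¬x⇾x≡x⇾x : ¬ ¬ x ⇾ x ≡ x ⇾ x
    ¬¬x⇾x≡x⇾x = begin
      ¬ ¬ x ⇾ x       ≡⟨ ⇾-classical (¬ ¬ x) x ⟩
      ¬ ¬ ¬ x ⊔ x     ≡⟨ cong (_⊔ x) (¬¬¬x≡¬x x) ⟩
      ¬ x ⊔ x         ≡⟨ ⇾-classical x x ⟨
      x ⇾ x           ∎
    𝟙≤¬¬x⇾x : 𝟙 ≤ ¬ ¬ x ⇾ x
    𝟙≤¬¬x⇾x = subst (𝟙 ≤_) (sym ¬¬x⇾x≡x⇾x) (𝟙≤⇾ (≤-refl x))

negated-BA-law : (A : FLe) → InG A → ∀ s t → BA⊨ s ≈ t → A ⊨ (¬ₜ s) ≈ (¬ₜ t)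
negated-BA-law A (_ , G-property , A⊨E) s t BA⊨s≈t =
  Equivalence.to (G-property s t) BA⊨s≈t A A⊨E

BA⊨∙≈⊓ : BA⊨ (var 0 ·ₜ var 1) ≈ (var 0 ∧ₜ var 1)
BA⊨∙≈⊓ _ (∙≡⊓ , _) ρ = ∙≡⊓ (ρ 0) (ρ 1)

BA⊨⇾≈¬⊔ : BA⊨ (var 0 →ₜ var 1) ≈ ((¬ₜ var 0) ∨ₜ var 1)
BA⊨⇾≈¬⊔ _ (_ , ⇾≡¬⊔) ρ = ⇾≡¬⊔ (ρ 0) (ρ 1)

InG∧involutive⇒isBA : (A : FLe) → InG A → Involutive _≡_ (FLe.¬_ A) → IsBA A
InG∧involutive⇒isBA A A∈G ¬¬-inv =
    holds (var 0 ·ₜ var 1) (var 0 ∧ₜ var 1) BA⊨∙≈⊓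
  , holds (var 0 →ₜ var 1) ((¬ₜ var 0) ∨ₜ var 1) BA⊨⇾≈¬⊔
  where
  open FLeProperties A using (¬-injective)

  valuation : Carrier A → Carrier A → ℕ → Carrier A
  valuation x _ zero    = x
  valuation _ y (suc _) = y

  holds : ∀ s t → BA⊨ s ≈ t → ∀ x y → ⟦ s ⟧ A (valuation x y) ≡ ⟦ t ⟧ A (valuation x y)
  holds s t BA⊨s≈t x y =
    ¬-injective ¬¬-inv (negated-BA-law A A∈G s t BA⊨s≈t (valuation x y))

lemma3p21 : (A : FLe) → InG A → (a : Arrow) → SymmetricOn A a ⇔ IsBA A
lemma3p21 A A∈G a = mk⇔
  (λ symmetric → InG∧involutive⇒isBA A A∈G (symmetric⇒involutive a symmetric))
  (λ isBA → involutive⇒symmetric (isBA⇒involutive isBA) a)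
  where open FLeProperties A
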